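{- Let $G$ be a finite simple bipartite graph, $k$ a positive integer, and $M$ a $k$-limited spanning subgraph of $G$. If $P$ is an $M$-augmenting trail in $G$ of minimum length among all $M$-augmenting trails in $G$, then $P$ is a path (i.e. its vertices $v_0,\dots,v_\ell$ are pairwise distinct).
   Context: A $k$-limited spanning subgraph of $G$ is a subgraph $M$ with $V(M)=V(G)$ and $d_M(v)\le k$ for every $v\in V(G)$. A vertex $v$ is filled (in $M$) if $d_M(v)=k$ and unfilled otherwise. A trail is a sequence $v_0e_1v_1e_2\cdots e_\ell v_\ell$ of vertices and pairwise distinct edges with $e_i=v_{i-1}v_i$. An $M$-augmenting trail is a trail $v_0e_1v_1\cdots e_\ell v_\ell$ whose edges alternate between edges not in $M$ and edges in $M$, with the first edge $e_1$ and the last edge $e_\ell$ not in $M$ (so $\ell$ is odd), such that the end vertices $v_0$ and $v_\ell$ are unfilled in $M$, all inner vertices $v_1,\dots,v_{\ell-1}$ are filled in $M$, and, in case $v_0=v_\ell$, additionally $d_M(v_0)<k-1$. -}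

module Defs where

open import Data.Nat using (ℕ; zero; suc; _≤_; _<_)
open import Data.Bool using (Bool; true; false; not)
open import Data.Fin using (Fin; toℕ; inject₁; fromℕ)
open import Data.List using (length; filterᵇ; allFin)
open import Data.Product using (_×_; Σ; _,_)
open import Data.Sum using (_⊎_)
open import Relation.Binary.PropositionalEquality using (_≡_; _≢_)
open import Relation.Nullary using (¬_)

record Graph (n : ℕ) : Set where
  field
    adj   : Fin n → Fin n → Bool
    sym   : ∀ u v → adj u v ≡ adj v u
    irrefl : ∀ v → adj v v ≡ false
open Graph public

Bipartite : {n : ℕ} → Graph n → Set
Bipartite {n} G = Σ (Fin n → Bool) λ c → ∀ u v → adj G u v ≡ true → c u ≢ c v

record SpanningSubgraph {n : ℕ} (G : Graph n) : Set where
  field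
    madj  : Fin n → Fin n → Bool
    msym  : ∀ u v → madj u v ≡ madj v u
    msub  : ∀ u v → madj u v ≡ true → adj G u v ≡ true
open SpanningSubgraph public

deg : {n : ℕ} {G : Graph n} → SpanningSubgraph G → Fin n → ℕ
deg {n} M v = length (filterᵇ (madj M v) (allFin n))

KLimited : {n : ℕ} {G : Graph n} → ℕ → SpanningSubgraph G → Set
KLimited {n} k M = ∀ (v : Fin n) → deg M v ≤ k

Filled : {n : ℕ} {G : Graph n} → ℕ → SpanningSubgraph G → Fin n → Set
Filled k M v = deg M v ≡ k

Unfilled : {n : ℕ} {G : Graph n} → ℕ → SpanningSubgraph G → Fin n → Set
Unfilled k M v = ¬ (deg M v ≡ k)

isOdd : ℕ → Bool
isOdd zero = false
isOdd (suc m) = not (isOdd m)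

-- A trail of length ℓ: vertices v₀ … v_ℓ (a function Fin (suc ℓ) → Fin n);
-- edge e_{i+1} (i : Fin ℓ) is v_i v_{i+1}.
module _ {n : ℕ} where
  src tgt : {ℓ : ℕ} → (Fin (suc ℓ) → Fin n) → Fin ℓ → Fin n
  src vs i = vs (inject₁ i)
  tgt vs i = vs (Data.Fin.suc i)

  SameEdge : Fin n → Fin n → Fin n → Fin n → Set
  SameEdge a b c d = (a ≡ c × b ≡ d) ⊎ (a ≡ d × b ≡ c)

  IsTrail : (G : Graph n) (ℓ : ℕ) → (Fin (suc ℓ) → Fin n) → Set
  IsTrail G ℓ vs =
    (∀ i → adj G (src vs i) (tgt vs i) ≡ true) ×
    (∀ i j → SameEdge (src vs i) (tgt vs i) (src vs j) (tgt vs j) → i ≡ j)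

  -- M-augmenting trail (edges indexed from 0: edge i lies in M iff i is odd,
  -- so e₁ ∉ M, e₂ ∈ M, …; ℓ odd means the last edge is not in M).
  IsAugmenting : (G : Graph n) (k : ℕ) (M : SpanningSubgraph G)
                 (ℓ : ℕ) → (Fin (suc ℓ) → Fin n) → Set
  IsAugmenting G k M ℓ vs =
    IsTrail G ℓ vs ×
    (∀ i → madj M (src vs i) (tgt vs i) ≡ isOdd (toℕ i)) ×
    isOdd ℓ ≡ true ×
    Unfilled k M (vs Data.Fin.zero) ×
    Unfilled k M (vs (fromℕ ℓ)) ×
    (∀ (j : Fin (suc ℓ)) → 0 < toℕ j → toℕ j < ℓ → Filled k M (vs j)) ×
    (vs Data.Fin.zero ≡ vs (fromℕ ℓ) → suc (deg M (vs Data.Fin.zero)) < k)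

-- If v_i = v_j with i < j, bipartiteness makes j − i even, so deleting the closed
-- subtrail between positions i and j leaves a shorter sequence whose edges keep their
-- parity (hence their membership in M), whose inner vertices are inner vertices of the
-- original trail and whose ends are unchanged: a shorter M-augmenting trail.
module Submission where

open import Defs hiding (sym)
open import Data.Bool using (Bool; true; false; not; _xor_)
open import Data.Bool.Properties
  using (¬-not; not-injective; not-distribˡ-xor; not-distribʳ-xor; xor-identityʳ)
open import Data.Empty using (⊥-elim)
open import Data.Fin using (Fin; zero; suc; toℕ; fromℕ; fromℕ<; inject₁; lower₁)
open import Data.Fin.Properties
  using (toℕ-injective; toℕ-fromℕ; toℕ-fromℕ<; toℕ-inject₁; toℕ-lower₁; inject₁-lower₁; toℕ<n)
  renaming (<-cmp to <-cmpᶠ)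
open import Data.Nat using (ℕ; zero; suc; _+_; _∸_; _≤_; _<_; z≤n; s≤s)
open import Data.Nat.Properties
open import Data.Product using (Σ; _×_; _,_; proj₁)
open import Data.Sum using (_⊎_; inj₁; inj₂)
import Data.Sum as Sum
open import Function using (_∘_; id)
open import Function.Definitions using (Injective)
open import Relation.Binary using (Tri; tri<; tri≈; tri>)
open import Relation.Binary.PropositionalEquality
open import Relation.Nullary using (¬_)

isOdd-+ : ∀ m n → isOdd (m + n) ≡ isOdd m xor isOdd n
isOdd-+ zero    n = refl
isOdd-+ (suc m) n = trans (cong not (isOdd-+ m n)) (not-distribˡ-xor (isOdd m) (isOdd n))

isOdd-+-even : ∀ m {d} → isOdd d ≡ false → isOdd (m + d) ≡ isOdd m
isOdd-+-even m {d} d-even = begin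
  isOdd (m + d)        ≡⟨ isOdd-+ m d ⟩
  isOdd m xor isOdd d  ≡⟨ cong (isOdd m xor_) d-even ⟩
  isOdd m xor false    ≡⟨ xor-identityʳ (isOdd m) ⟩
  isOdd m              ∎
  where open ≡-Reasoning

xor-cancelˡ : ∀ x {y z} → x xor y ≡ x xor z → y ≡ z
xor-cancelˡ true  = not-injective
xor-cancelˡ false = id

isOdd-+-cancelˡ : ∀ m {d} → isOdd m ≡ isOdd (m + d) → isOdd d ≡ false
isOdd-+-cancelˡ m {d} same = xor-cancelˡ (isOdd m) (begin
  isOdd m xor isOdd d  ≡⟨ isOdd-+ m d ⟨
  isOdd (m + d)        ≡⟨ same ⟨
  isOdd m              ≡⟨ xor-identityʳ (isOdd m) ⟨
  isOdd m xor false    ∎)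
  where open ≡-Reasoning

alternating-parity : ∀ {ℓ} (f : Fin (suc ℓ) → Bool) → (∀ i → f (suc i) ≡ not (f (inject₁ i))) →
                     ∀ x → f x ≡ f zero xor isOdd (toℕ x)
alternating-parity f alternates zero = sym (xor-identityʳ (f zero))
alternating-parity {suc ℓ} f alternates (suc x) = begin
  f (suc x)                        ≡⟨ alternates x ⟩
  not (f (inject₁ x))              ≡⟨ cong not (alternating-parity (f ∘ inject₁) (alternates ∘ inject₁) x) ⟩
  not (f zero xor isOdd (toℕ x))   ≡⟨ not-distribʳ-xor (f zero) (isOdd (toℕ x)) ⟩
  f zero xor isOdd (toℕ (suc x))   ∎
  where open ≡-Reasoning

walk-parity : ∀ {n} (G : Graph n) → Bipartite G →
              ∀ {ℓ} (vs : Fin (suc ℓ) → Fin n) → (∀ i → adj G (src vs i) (tgt vs i) ≡ true) →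
              ∀ x y → vs x ≡ vs y → isOdd (toℕ x) ≡ isOdd (toℕ y)
walk-parity G (colour , proper) vs edges x y vx≡vy = xor-cancelˡ (colour (vs zero)) (begin
  colour (vs zero) xor isOdd (toℕ x)  ≡⟨ colouring x ⟨
  colour (vs x)                        ≡⟨ cong colour vx≡vy ⟩
  colour (vs y)                        ≡⟨ colouring y ⟩
  colour (vs zero) xor isOdd (toℕ y)  ∎)
  where
  open ≡-Reasoning
  colouring : ∀ x → colour (vs x) ≡ colour (vs zero) xor isOdd (toℕ x)
  colouring = alternating-parity (colour ∘ vs) (λ i → ¬-not (≢-sym (proper _ _ (edges i))))

SameEdge-resp : ∀ {n} {a a′ b b′ c c′ d d′ : Fin n} → a ≡ a′ → b ≡ b′ → c ≡ c′ → d ≡ d′ →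
                SameEdge a b c d → SameEdge a′ b′ c′ d′
SameEdge-resp refl refl refl refl same = same

-- edge-≥ is what makes every inner vertex of ws an inner vertex of vs.
record Shortcut {n ℓ′ ℓ : ℕ} (ws : Fin (suc ℓ′) → Fin n) (vs : Fin (suc ℓ) → Fin n) : Set where
  field
    edge           : Fin ℓ′ → Fin ℓ
    edge-injective : Injective _≡_ _≡_ edge
    src-edge       : ∀ e → src ws e ≡ src vs (edge e)
    tgt-edge       : ∀ e → tgt ws e ≡ tgt vs (edge e)
    edge-parity    : ∀ e → isOdd (toℕ (edge e)) ≡ isOdd (toℕ e)
    edge-≥         : ∀ e → toℕ e ≤ toℕ (edge e)
    first          : ws zero ≡ vs zero
    last           : ws (fromℕ ℓ′) ≡ vs (fromℕ ℓ)
    length-parity  : isOdd ℓ′ ≡ isOdd ℓ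

shortcut-augmenting : ∀ {n} (G : Graph n) k M {ℓ′ ℓ} {ws : Fin (suc ℓ′) → Fin n} {vs : Fin (suc ℓ) → Fin n} →
                      Shortcut ws vs → IsAugmenting G k M ℓ vs → IsAugmenting G k M ℓ′ ws
shortcut-augmenting G k M {ℓ′} {ℓ} {ws} {vs} shortcut
  ((edges , distinct) , inM , ℓ-odd , unfilled-first , unfilled-last , filled , closed) =
    (edges′ , distinct′) , inM′ , trans length-parity ℓ-odd
  , subst (Unfilled k M) (sym first) unfilled-first
  , subst (Unfilled k M) (sym last) unfilled-last
  , filled′
  , λ ends → subst (λ v → suc (deg M v) < k) (sym first) (closed (trans (sym first) (trans ends last)))
  where
  open Shortcut shortcut

  edges′ : ∀ e → adj G (src ws e) (tgt ws e) ≡ true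
  edges′ e = subst₂ (λ u v → adj G u v ≡ true) (sym (src-edge e)) (sym (tgt-edge e)) (edges (edge e))

  distinct′ : ∀ e e′ → SameEdge (src ws e) (tgt ws e) (src ws e′) (tgt ws e′) → e ≡ e′
  distinct′ e e′ same = edge-injective (distinct (edge e) (edge e′)
    (SameEdge-resp (src-edge e) (tgt-edge e) (src-edge e′) (tgt-edge e′) same))

  inM′ : ∀ e → madj M (src ws e) (tgt ws e) ≡ isOdd (toℕ e)
  inM′ e = trans (cong₂ (madj M) (src-edge e) (tgt-edge e)) (trans (inM (edge e)) (edge-parity e))

  filled′ : ∀ x → 0 < toℕ x → toℕ x < ℓ′ → Filled k M (ws x)
  filled′ x 0<x x<ℓ′ = subst (Filled k M) (sym ws-x) (filled (inject₁ (edge e)) inner inner-bound)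
    where
    e : Fin ℓ′
    e = lower₁ x (>⇒≢ x<ℓ′)
    ws-x : ws x ≡ vs (inject₁ (edge e))
    ws-x = trans (cong ws (sym (inject₁-lower₁ x _))) (src-edge e)
    inner : 0 < toℕ (inject₁ (edge e))
    inner = <-≤-trans 0<x (begin
      toℕ x                     ≡⟨ toℕ-lower₁ x _ ⟨
      toℕ e                     ≤⟨ edge-≥ e ⟩
      toℕ (edge e)              ≡⟨ toℕ-inject₁ (edge e) ⟨
      toℕ (inject₁ (edge e))    ∎)
      where open ≤-Reasoning
    inner-bound : toℕ (inject₁ (edge e)) < ℓ
    inner-bound = subst (_< ℓ) (sym (toℕ-inject₁ (edge e))) (toℕ<n (edge e))

skip : ℕ → ℕ → ℕ → ℕ
skip d zero    t       = t + d
skip d (suc c) zero    = zero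
skip d (suc c) (suc t) = suc (skip d c t)

m≤skip : ∀ d c t → t ≤ skip d c t
m≤skip d zero    t       = m≤m+n t d
m≤skip d (suc c) zero    = z≤n
m≤skip d (suc c) (suc t) = s≤s (m≤skip d c t)

skip-≥ : ∀ d {c t} → c ≤ t → skip d c t ≡ t + d
skip-≥ d {zero}          _         = refl
skip-≥ d {suc c} {suc t} (s≤s c≤t) = cong suc (skip-≥ d c≤t)

skip-injective : ∀ d c → Injective _≡_ _≡_ (skip d c)
skip-injective d zero    {t}     {u}     = +-cancelʳ-≡ d t u
skip-injective d (suc c) {zero}  {zero}  _  = refl
skip-injective d (suc c) {suc t} {suc u} eq = cong suc (skip-injective d c (suc-injective eq))

skip-parity : ∀ {d} → isOdd d ≡ false → ∀ c t → isOdd (skip d c t) ≡ isOdd t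
skip-parity d-even zero    t       = isOdd-+-even t d-even
skip-parity d-even (suc c) zero    = refl
skip-parity d-even (suc c) (suc t) = cong not (skip-parity d-even c t)

skip-< : ∀ d {c m t} → c ≤ m → t < m → skip d c t < m + d
skip-< d {zero}                  _         t<m       = +-monoˡ-< d t<m
skip-< d {suc c} {suc m} {zero}  _         _         = s≤s z≤n
skip-< d {suc c} {suc m} {suc t} (s≤s c≤m) (s≤s t<m) = s≤s (skip-< d c≤m t<m)

skip-suc : ∀ d c t → skip d (suc c) t ≡ skip d c t ⊎ (skip d (suc c) t ≡ c × skip d c t ≡ c + d)
skip-suc d zero    zero    = inj₂ (refl , refl)
skip-suc d zero    (suc t) = inj₁ refl
skip-suc d (suc c) zero    = inj₁ refl
skip-suc d (suc c) (suc t) =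
  Sum.map (cong suc) (λ (p , q) → cong suc p , cong suc q) (skip-suc d c t)

-- Vertex positions are renumbered by skip d (suc i) and edge positions by skip d i;
-- the two disagree only where position i is sent to i + d, which carries the same
-- vertex because of the loop.
module Excision {n ℓ ℓ′ d : ℕ} (vs : Fin (suc ℓ) → Fin n) (i j : Fin (suc ℓ))
  (loop : vs i ≡ vs j) (gap : toℕ i + d ≡ toℕ j) (length : ℓ′ + d ≡ ℓ)
  (d-even : isOdd d ≡ false) where

  i≤ℓ′ : toℕ i ≤ ℓ′
  i≤ℓ′ = +-cancelʳ-≤ d (toℕ i) ℓ′ (subst₂ _≤_ (sym gap) (sym length) (≤-pred (toℕ<n j)))

  position : Fin (suc ℓ′) → Fin (suc ℓ)
  position x = fromℕ<
    (subst (λ m → skip d (suc (toℕ i)) (toℕ x) < suc m) length (skip-< d (s≤s i≤ℓ′) (toℕ<n x)))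

  edge : Fin ℓ′ → Fin ℓ
  edge e = fromℕ< (subst (skip d (toℕ i) (toℕ e) <_) length (skip-< d i≤ℓ′ (toℕ<n e)))

  ws : Fin (suc ℓ′) → Fin n
  ws = vs ∘ position

  toℕ-position : ∀ x → toℕ (position x) ≡ skip d (suc (toℕ i)) (toℕ x)
  toℕ-position x = toℕ-fromℕ< _

  toℕ-edge : ∀ e → toℕ (edge e) ≡ skip d (toℕ i) (toℕ e)
  toℕ-edge e = toℕ-fromℕ< _

  vs-skip : ∀ x y t → toℕ x ≡ skip d (suc (toℕ i)) t → toℕ y ≡ skip d (toℕ i) t → vs x ≡ vs y
  vs-skip x y t x≡ y≡ with skip-suc d (toℕ i) t
  ... | inj₁ same          = cong vs (toℕ-injective (trans x≡ (trans same (sym y≡))))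
  ... | inj₂ (at-i , at-j) = begin
    vs x  ≡⟨ cong vs (toℕ-injective (trans x≡ at-i)) ⟩
    vs i  ≡⟨ loop ⟩
    vs j  ≡⟨ cong vs (toℕ-injective (trans y≡ (trans at-j gap))) ⟨
    vs y  ∎
    where open ≡-Reasoning

  shortcut : Shortcut ws vs
  shortcut = record
    { edge           = edge
    ; edge-injective = λ {e} {e′} eq → toℕ-injective (skip-injective d (toℕ i)
                         (trans (sym (toℕ-edge e)) (trans (cong toℕ eq) (toℕ-edge e′))))
    ; src-edge       = λ e → vs-skip (position (inject₁ e)) (inject₁ (edge e)) (toℕ e)
                         (trans (toℕ-position (inject₁ e)) (cong (skip d (suc (toℕ i))) (toℕ-inject₁ e)))
                         (trans (toℕ-inject₁ (edge e)) (toℕ-edge e))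
    ; tgt-edge       = λ e → cong vs (toℕ-injective (trans (toℕ-position (suc e)) (cong suc (sym (toℕ-edge e)))))
    ; edge-parity    = λ e → trans (cong isOdd (toℕ-edge e)) (skip-parity d-even (toℕ i) (toℕ e))
    ; edge-≥         = λ e → subst (toℕ e ≤_) (sym (toℕ-edge e)) (m≤skip d (toℕ i) (toℕ e))
    ; first          = cong vs (toℕ-injective (toℕ-position zero))
    ; last           = vs-skip (position (fromℕ ℓ′)) (fromℕ ℓ) ℓ′
                         (trans (toℕ-position (fromℕ ℓ′)) (cong (skip d (suc (toℕ i))) (toℕ-fromℕ ℓ′)))
                         (trans (toℕ-fromℕ ℓ) (trans (sym length) (sym (skip-≥ d i≤ℓ′))))
    ; length-parity  = trans (sym (isOdd-+-even ℓ′ d-even)) (cong isOdd length)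
    }

shorter-augmenting-trail : ∀ {n} (G : Graph n) k M {ℓ} {vs : Fin (suc ℓ) → Fin n} →
  Bipartite G → IsAugmenting G k M ℓ vs → ∀ {i j} → vs i ≡ vs j → toℕ i < toℕ j →
  Σ ℕ λ ℓ′ → ℓ′ < ℓ × Σ (Fin (suc ℓ′) → Fin n) (IsAugmenting G k M ℓ′)
shorter-augmenting-trail G k M {ℓ} {vs} bipartite aug {i} {j} loop i<j =
  ℓ ∸ d , shorter , Excision.ws vs i j loop gap length d-even
        , shortcut-augmenting G k M (Excision.shortcut vs i j loop gap length d-even) aug
  where
  d : ℕ
  d = toℕ j ∸ toℕ i
  gap : toℕ i + d ≡ toℕ j
  gap = m+[n∸m]≡n (<⇒≤ i<j)
  length : ℓ ∸ d + d ≡ ℓ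
  length = m∸n+n≡m (≤-trans (m∸n≤m (toℕ j) (toℕ i)) (≤-pred (toℕ<n j)))
  d-even : isOdd d ≡ false
  d-even = isOdd-+-cancelˡ (toℕ i)
    (trans (walk-parity G bipartite vs (proj₁ (proj₁ aug)) i j loop) (cong isOdd (sym gap)))
  shorter : ℓ ∸ d < ℓ
  shorter = subst (ℓ ∸ d <_) length (m<m+n (ℓ ∸ d) (m<n⇒0<n∸m i<j))

claim3p1 : (n : ℕ) (G : Graph n) → Bipartite G →
    (k : ℕ) → 1 ≤ k → (M : SpanningSubgraph G) → KLimited k M →
    (ℓ : ℕ) (vs : Fin (suc ℓ) → Fin n) → IsAugmenting G k M ℓ vs →
    (∀ (ℓ′ : ℕ) (ws : Fin (suc ℓ′) → Fin n) → IsAugmenting G k M ℓ′ ws → ℓ ≤ ℓ′) →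
    ∀ (i j : Fin (suc ℓ)) → vs i ≡ vs j → i ≡ j
claim3p1 n G bipartite k _ M _ ℓ vs aug minimal i j loop = by-order (<-cmpᶠ i j)
  where
  no-shorter : ¬ Σ ℕ λ ℓ′ → ℓ′ < ℓ × Σ (Fin (suc ℓ′) → Fin n) (IsAugmenting G k M ℓ′)
  no-shorter (ℓ′ , ℓ′<ℓ , ws , aug′) = <⇒≱ ℓ′<ℓ (minimal ℓ′ ws aug′)

  by-order : Tri (toℕ i < toℕ j) (i ≡ j) (toℕ j < toℕ i) → i ≡ j
  by-order (tri< i<j _ _) = ⊥-elim (no-shorter (shorter-augmenting-trail G k M bipartite aug loop i<j))
  by-order (tri≈ _ i≡j _) = i≡j
  by-order (tri> _ _ j<i) = ⊥-elim (no-shorter (shorter-augmenting-trail G k M bipartite aug (sym loop) j<i))
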